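{- Let $(\widetilde J_2(n))_{n\ge0}$ be defined by $\widetilde J_2(0)=1$, $\widetilde J_2(1)=\frac34$ and $4n^2\widetilde J_2(n)-(8n^2-8n+3)\widetilde J_2(n-1)+4(n-1)^2\widetilde J_2(n-2)=0$ for $n\ge2$, and $(\widetilde J_3(n))_{n\ge0}$ by $\widetilde J_3(0)=0$, $\widetilde J_3(1)=\frac12$ and $4n^2\widetilde J_3(n)-(8n^2-8n+3)\widetilde J_3(n-1)+4(n-1)^2\widetilde J_3(n-2)=\frac{2^n(n-1)!}{(2n-1)!!}$ for $n\ge2$. For $k=2,3$ let $\widetilde g_k(x)=\sum_{n\ge0}\binom{ -\frac12}{n}\widetilde J_k(n)x^n$, and let $$D_{\mathrm W}=8x^2(1+x)^2\frac{d^3}{dx^3}+24x(1+x)(1+2x)\frac{d^2}{dx^2}+2(4+27x+27x^2)\frac{d}{dx}+3(1+2x).$$ Then, as power series in $x$ (with $\frac1{1+x}=\sum_{n\ge0}(-x)^n$), $$D_{\mathrm W}\widetilde g_2(x)=0,\qquad D_{\mathrm W}\widetilde g_3(x)=-\frac{2}{1+x}.$$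
   Context: $\binom{ -1/2}{n}$ is the generalized binomial coefficient $\frac{(-1/2)(-3/2)\cdots(-1/2-n+1)}{n!}$ and $(2n-1)!!=1\cdot3\cdots(2n-1)$. -}

module Defs where

open import Data.Nat as ℕ using (ℕ; zero; suc; NonZero; _!)
open import Data.Nat.Properties using (m*n≢0)
open import Data.Integer using (+_)
open import Data.Rational using (ℚ; 0ℚ; 1ℚ; -½; _+_; _*_; _-_; -_; _/_)
open import Relation.Binary.PropositionalEquality using (_≡_)

ι : ℕ → ℚ
ι n = + n / 1

gbinom : ℚ → ℕ → ℚ
gbinom a zero    = 1ℚ
gbinom a (suc n) = gbinom a n * ((a - ι n) * (+ 1 / suc n))

-- odd double factorial  (2n-1)!! = 1·3···(2n-1), with (-1)!! = 1
oddDF : ℕ → ℕ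
oddDF zero    = 1
oddDF (suc n) = oddDF n ℕ.* suc (2 ℕ.* n)

oddDF-nonZero : ∀ n → NonZero (oddDF n)
oddDF-nonZero zero    = _
oddDF-nonZero (suc n) = m*n≢0 (oddDF n) (suc (2 ℕ.* n)) {{oddDF-nonZero n}}

rhsJ3 : ℕ → ℚ
rhsJ3 n = _/_ (+ (2 ℕ.^ n ℕ.* (n ℕ.∸ 1) !)) (oddDF n) {{oddDF-nonZero n}}

FPS : Set
FPS = ℕ → ℚ

_≈ₛ_ : FPS → FPS → Set
f ≈ₛ g = ∀ n → f n ≡ g n

infixl 6 _⊕_
infixl 7 _⊛_

_⊕_ : FPS → FPS → FPS
(f ⊕ g) n = f n + g n

sumTo : ℕ → (ℕ → ℚ) → ℚ
sumTo zero    h = h 0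
sumTo (suc n) h = sumTo n h + h (suc n)

_⊛_ : FPS → FPS → FPS
(f ⊛ g) n = sumTo n (λ i → f i * g (n ℕ.∸ i))

C : ℚ → FPS
C c zero    = c
C c (suc _) = 0ℚ

X : FPS
X 1 = 1ℚ
X _ = 0ℚ

d : FPS → FPS
d f n = ι (suc n) * f (suc n)

invOnePlusX : FPS
invOnePlusX zero    = 1ℚ
invOnePlusX (suc n) = - invOnePlusX n

DW : FPS → FPS
DW g =
    C (ι 8) ⊛ X ⊛ X ⊛ (C 1ℚ ⊕ X) ⊛ (C 1ℚ ⊕ X) ⊛ d (d (d g))
  ⊕ C (ι 24) ⊛ X ⊛ (C 1ℚ ⊕ X) ⊛ (C 1ℚ ⊕ C (ι 2) ⊛ X) ⊛ d (d g)
  ⊕ C (ι 2) ⊛ (C (ι 4) ⊕ C (ι 27) ⊛ X ⊕ C (ι 27) ⊛ X ⊛ X) ⊛ d g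
  ⊕ C (ι 3) ⊛ (C 1ℚ ⊕ C (ι 2) ⊛ X) ⊛ g

gSeries : (ℕ → ℚ) → FPS
gSeries J n = gbinom -½ n * J n

-- left-hand side of the recurrence at index n+2
recLHS : (ℕ → ℚ) → ℕ → ℚ
recLHS J m =
  ι 4 * ι (suc (suc m)) * ι (suc (suc m)) * J (suc (suc m))
  - (ι 8 * ι (suc (suc m)) * ι (suc (suc m)) - ι 8 * ι (suc (suc m)) + ι 3) * J (suc m)
  + ι 4 * ι (suc m) * ι (suc m) * J m

-- Write g = Σ b(n) J(n) xⁿ with b(n) = binom(−1/2, n). On coefficients, xʳ dʳ acts as multiplication
-- by the falling factorial n(n−1)⋯(n−r+1), and every monomial xᵃ dʳ of D_W has a ≤ r + 1, so the
-- coefficient of x^(m+1) in D_W g is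
--   8(m+2)³ g(m+2) + (2m+3)(8m²+24m+19) g(m+1) + 2(m+1)(2m+1)(2m+3) g(m).
-- Since 2(n+1) b(n+1) = −(2n+1) b(n), this is −(2m+3) b(m+1) times the left-hand side of the
-- recurrence for J at n = m+2. It therefore vanishes for J̃₂, while for J̃₃ the closed form
-- b(n) 2ⁿ n! = (−1)ⁿ (2n−1)!! turns it into −2 (−1)^(m+1). The constant coefficient is 8 g(1) + 3 g(0).
module Submission where

open import Defs
open import Data.Nat as ℕ using (ℕ; zero; suc; _≤_; _<_; _⊔_; z≤n; s≤s)
open import Data.Nat.Properties as ℕ
  using (≤-total; ≤-refl; m≤n⇒m<n∨m≡n; ≤-<-trans; m≤m⊔n; m≤n⊔m; +-monoˡ-≤)
open import Data.Integer as ℤ using (+_; -[1+_])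
import Data.Integer.Properties as ℤ
import Data.Integer.Tactic.RingSolver as ℤ-Solver
open import Data.Rational using (ℚ; 0ℚ; 1ℚ; _+_; _*_; _-_; -_; _/_; -½; toℚᵘ)
open import Data.Rational.Properties
  using (+-*-commutativeRing; _≟_; *-zeroˡ; *-zeroʳ; +-identityʳ; *-identityˡ; *-identityʳ; *-assoc;
         toℚᵘ-injective; toℚᵘ-fromℚᵘ; toℚᵘ-homo-+; toℚᵘ-homo-*)
import Data.Rational.Unnormalised as ℚᵘ
import Data.Rational.Unnormalised.Properties as ℚᵘ
open import Data.Sum using (_⊎_; inj₁; inj₂)
open import Data.Product using (_×_; _,_)
open import Data.List using (List; _∷_; [])
open import Relation.Nullary.Decidable using (dec⇒maybe)
open import Tactic.RingSolver using (solve; solve-∀)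
open import Tactic.RingSolver.Core.AlmostCommutativeRing using (AlmostCommutativeRing; fromCommutativeRing)
open import Relation.Binary.PropositionalEquality

ℚ-ring : AlmostCommutativeRing _ _
ℚ-ring = fromCommutativeRing +-*-commutativeRing (λ x → dec⇒maybe (0ℚ ≟ x))

toℚᵘ-ι : ∀ n → toℚᵘ (ι n) ℚᵘ.≃ ℚᵘ.mkℚᵘ (+ n) 0
toℚᵘ-ι n = toℚᵘ-fromℚᵘ (ℚᵘ.mkℚᵘ (+ n) 0)

ι-suc : ∀ n → ι (suc n) ≡ ι n + 1ℚ
ι-suc n = toℚᵘ-injective (begin
    toℚᵘ (ι (suc n))                ≈⟨ toℚᵘ-ι (suc n) ⟩
    ℚᵘ.mkℚᵘ (+ suc n) 0             ≈⟨ ℚᵘ.*≡* (numerators (+ n)) ⟩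
    ℚᵘ.mkℚᵘ (+ n) 0 ℚᵘ.+ ℚᵘ.1ℚᵘ      ≈⟨ ℚᵘ.+-cong (ℚᵘ.≃-sym (toℚᵘ-ι n)) ℚᵘ.≃-refl ⟩
    toℚᵘ (ι n) ℚᵘ.+ toℚᵘ 1ℚ         ≈⟨ ℚᵘ.≃-sym (toℚᵘ-homo-+ (ι n) 1ℚ) ⟩
    toℚᵘ (ι n + 1ℚ)                 ∎)
  where
  open ℚᵘ.≃-Reasoning
  numerators : ∀ (k : ℤ.ℤ) → (+ 1 ℤ.+ k) ℤ.* + 1 ≡ (k ℤ.* + 1 ℤ.+ + 1 ℤ.* + 1) ℤ.* + 1
  numerators = ℤ-Solver.solve-∀

ι-* : ∀ m n → ι (m ℕ.* n) ≡ ι m * ι n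
ι-* m n = toℚᵘ-injective (begin
    toℚᵘ (ι (m ℕ.* n))                       ≈⟨ toℚᵘ-ι (m ℕ.* n) ⟩
    ℚᵘ.mkℚᵘ (+ (m ℕ.* n)) 0                  ≈⟨ ℚᵘ.*≡* (cong (ℤ._* + 1) (ℤ.pos-* m n)) ⟩
    ℚᵘ.mkℚᵘ (+ m) 0 ℚᵘ.* ℚᵘ.mkℚᵘ (+ n) 0
      ≈⟨ ℚᵘ.*-cong (ℚᵘ.≃-sym (toℚᵘ-ι m)) (ℚᵘ.≃-sym (toℚᵘ-ι n)) ⟩
    toℚᵘ (ι m) ℚᵘ.* toℚᵘ (ι n)               ≈⟨ ℚᵘ.≃-sym (toℚᵘ-homo-* (ι m) (ι n)) ⟩
    toℚᵘ (ι m * ι n)                         ∎)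
  where open ℚᵘ.≃-Reasoning

ι-*-/ : ∀ m n .{{_ : ℕ.NonZero n}} → ι n * (+ m / n) ≡ ι m
ι-*-/ m (suc k) = toℚᵘ-injective (begin
    toℚᵘ (ι (suc k) * (+ m / suc k))               ≈⟨ toℚᵘ-homo-* (ι (suc k)) (+ m / suc k) ⟩
    toℚᵘ (ι (suc k)) ℚᵘ.* toℚᵘ (+ m / suc k)
      ≈⟨ ℚᵘ.*-cong (toℚᵘ-ι (suc k)) (toℚᵘ-fromℚᵘ (ℚᵘ.mkℚᵘ (+ m) k)) ⟩
    ℚᵘ.mkℚᵘ (+ suc k) 0 ℚᵘ.* ℚᵘ.mkℚᵘ (+ m) k        ≈⟨ ℚᵘ.*≡* cross ⟩
    ℚᵘ.mkℚᵘ (+ m) 0                                ≈⟨ ℚᵘ.≃-sym (toℚᵘ-ι m) ⟩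
    toℚᵘ (ι m)                                     ∎)
  where
  open ℚᵘ.≃-Reasoning
  cross : (+ suc k ℤ.* + m) ℤ.* + 1 ≡ + m ℤ.* + suc (k ℕ.+ 0)
  cross = trans (ℤ.*-identityʳ _)
                (trans (ℤ.*-comm (+ suc k) (+ m)) (cong (λ j → + m ℤ.* + suc j) (sym (ℕ.+-identityʳ k))))

*-cancelʳ-invertible : ∀ {a b c u} → c * u ≡ 1ℚ → a * c ≡ b * c → a ≡ b
*-cancelʳ-invertible {a} {b} {c} {u} cu≡1 ac≡bc = begin
  a             ≡⟨ *-identityʳ a ⟨
  a * 1ℚ        ≡⟨ cong (a *_) cu≡1 ⟨
  a * (c * u)   ≡⟨ *-assoc a c u ⟨
  a * c * u     ≡⟨ cong (_* u) ac≡bc ⟩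
  b * c * u     ≡⟨ *-assoc b c u ⟩
  b * (c * u)   ≡⟨ cong (b *_) cu≡1 ⟩
  b * 1ℚ        ≡⟨ *-identityʳ b ⟩
  b             ∎
  where open ≡-Reasoning

sumTo-cong : ∀ n {F G : ℕ → ℚ} → (∀ i → i ≤ n → F i ≡ G i) → sumTo n F ≡ sumTo n G
sumTo-cong zero    F≡G = F≡G 0 z≤n
sumTo-cong (suc n) F≡G =
  cong₂ _+_ (sumTo-cong n (λ i i≤n → F≡G i (ℕ.m≤n⇒m≤1+n i≤n))) (F≡G (suc n) ≤-refl)

sumTo-vanishes : ∀ n {F : ℕ → ℚ} → (∀ i → i ≤ n → F i ≡ 0ℚ) → sumTo n F ≡ 0ℚ
sumTo-vanishes zero    F≡0 = F≡0 0 z≤n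
sumTo-vanishes (suc n) F≡0 =
  cong₂ _+_ (sumTo-vanishes n (λ i i≤n → F≡0 i (ℕ.m≤n⇒m≤1+n i≤n))) (F≡0 (suc n) ≤-refl)

sumTo-extend : ∀ {a} b {F : ℕ → ℚ} → (∀ i → a < i → F i ≡ 0ℚ) → a ≤ b → sumTo b F ≡ sumTo a F
sumTo-extend zero    F≡0 z≤n = refl
sumTo-extend {a} (suc b) {F} F≡0 a≤1+b with m≤n⇒m<n∨m≡n a≤1+b
... | inj₂ refl      = refl
... | inj₁ (s≤s a≤b) = begin
  sumTo b F + F (suc b) ≡⟨ cong₂ _+_ (sumTo-extend b F≡0 a≤b) (F≡0 (suc b) (s≤s a≤b)) ⟩
  sumTo a F + 0ℚ        ≡⟨ +-identityʳ _ ⟩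
  sumTo a F             ∎
  where open ≡-Reasoning

shift : ℕ → FPS → FPS
shift zero    h n       = h n
shift (suc i) h zero    = 0ℚ
shift (suc i) h (suc n) = shift i h n

shift-≤ : ∀ i h {n} → i ≤ n → shift i h n ≡ h (n ℕ.∸ i)
shift-≤ zero    h i≤n       = refl
shift-≤ (suc i) h (s≤s i≤n) = shift-≤ i h i≤n

shift-< : ∀ i h {n} → n < i → shift i h n ≡ 0ℚ
shift-< (suc i) h {zero}  n<i       = refl
shift-< (suc i) h {suc n} (s≤s n<i) = shift-< i h n<i

Degree≤ : FPS → ℕ → Set
Degree≤ f k = ∀ i → k < i → f i ≡ 0ℚ

polynomial-⊛ : ∀ {P k} → Degree≤ P k → ∀ h n → (P ⊛ h) n ≡ sumTo k (λ i → P i * shift i h n)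
polynomial-⊛ {P} {k} deg h n = begin
  sumTo n (λ i → P i * h (n ℕ.∸ i)) ≡⟨ sumTo-cong n (λ i i≤n → cong (P i *_) (sym (shift-≤ i h i≤n))) ⟩
  sumTo n F                         ≡⟨ truncate (≤-total n k) ⟩
  sumTo k F                         ∎
  where
  open ≡-Reasoning
  F : ℕ → ℚ
  F i = P i * shift i h n
  truncate : n ≤ k ⊎ k ≤ n → sumTo n F ≡ sumTo k F
  truncate (inj₁ n≤k) =
    sym (sumTo-extend k (λ i n<i → trans (cong (P i *_) (shift-< i h n<i)) (*-zeroʳ (P i))) n≤k)
  truncate (inj₂ k≤n) =
    sumTo-extend n (λ i k<i → trans (cong (_* shift i h n) (deg i k<i)) (*-zeroˡ (shift i h n))) k≤n

C-degree : ∀ c → Degree≤ (C c) 0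
C-degree c (suc i) _ = refl

X-degree : Degree≤ X 1
X-degree (suc zero)    (s≤s ())
X-degree (suc (suc i)) _ = refl

⊕-degree : ∀ {f g a b} → Degree≤ f a → Degree≤ g b → Degree≤ (f ⊕ g) (a ⊔ b)
⊕-degree {a = a} {b} f-deg g-deg i a⊔b<i =
  cong₂ _+_ (f-deg i (≤-<-trans (m≤m⊔n a b) a⊔b<i)) (g-deg i (≤-<-trans (m≤n⊔m a b) a⊔b<i))

shift-degree : ∀ {g b} j → Degree≤ g b → Degree≤ (shift j g) (j ℕ.+ b)
shift-degree zero    g-deg i       b<i       = g-deg i b<i
shift-degree (suc j) g-deg (suc i) (s≤s j+b<i) = shift-degree j g-deg i j+b<i

⊛-degree : ∀ {f g a b} → Degree≤ f a → Degree≤ g b → Degree≤ (f ⊛ g) (a ℕ.+ b)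
⊛-degree {f} {g} {a} {b} f-deg g-deg i a+b<i = trans (polynomial-⊛ f-deg g i) (sumTo-vanishes a term≡0)
  where
  term≡0 : ∀ j → j ≤ a → f j * shift j g i ≡ 0ℚ
  term≡0 j j≤a =
    trans (cong (f j *_) (shift-degree j g-deg i (≤-<-trans (+-monoˡ-≤ b j≤a) a+b<i))) (*-zeroʳ (f j))

fallingFactorial : ℚ → ℕ → ℚ
fallingFactorial x zero    = 1ℚ
fallingFactorial x (suc r) = x * fallingFactorial (x - 1ℚ) r

d^ : ℕ → FPS → FPS
d^ zero    h = h
d^ (suc r) h = d^ r (d h)

ι-pred : ∀ n → ι (suc n) - 1ℚ ≡ ι n
ι-pred n = trans (cong (_- 1ℚ) (ι-suc n)) (+-∸-cancel (ι n))
  where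
  +-∸-cancel : ∀ x → x + 1ℚ - 1ℚ ≡ x
  +-∸-cancel = solve-∀ ℚ-ring

shift-d^ : ∀ r h n → shift r (d^ r h) n ≡ fallingFactorial (ι n) r * h n
shift-d^ zero    h n       = sym (*-identityˡ (h n))
shift-d^ (suc r) h zero    =
  sym (trans (cong (_* h 0) (*-zeroˡ (fallingFactorial (0ℚ - 1ℚ) r))) (*-zeroˡ (h 0)))
shift-d^ (suc r) h (suc n) = begin
  shift r (d^ r (d h)) n                         ≡⟨ shift-d^ r (d h) n ⟩
  fallingFactorial (ι n) r * (y * h (suc n))     ≡⟨ cong (λ x → fallingFactorial x r * (y * h (suc n))) (ι-pred n) ⟨
  fallingFactorial (y - 1ℚ) r * (y * h (suc n))  ≡⟨ rearrange (fallingFactorial (y - 1ℚ) r) y (h (suc n)) ⟩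
  y * fallingFactorial (y - 1ℚ) r * h (suc n)    ∎
  where
  open ≡-Reasoning
  y : ℚ
  y = ι (suc n)
  rearrange : ∀ a b c → a * (b * c) ≡ b * a * c
  rearrange = solve-∀ ℚ-ring

-- DW g is definitionally p₃ ⊛ d (d (d g)) ⊕ p₂ ⊛ d (d g) ⊕ p₁ ⊛ d g ⊕ p₀ ⊛ g.
p₃ p₂ p₁ p₀ : FPS
p₃ = C (ι 8) ⊛ X ⊛ X ⊛ (C 1ℚ ⊕ X) ⊛ (C 1ℚ ⊕ X)
p₂ = C (ι 24) ⊛ X ⊛ (C 1ℚ ⊕ X) ⊛ (C 1ℚ ⊕ C (ι 2) ⊛ X)
p₁ = C (ι 2) ⊛ (C (ι 4) ⊕ C (ι 27) ⊛ X ⊕ C (ι 27) ⊛ X ⊛ X)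
p₀ = C (ι 3) ⊛ (C 1ℚ ⊕ C (ι 2) ⊛ X)

p₃-degree : Degree≤ p₃ 4
p₃-degree = ⊛-degree (⊛-degree (⊛-degree (⊛-degree (C-degree _) X-degree) X-degree) 1+x-degree) 1+x-degree
  where
  1+x-degree : Degree≤ (C 1ℚ ⊕ X) 1
  1+x-degree = ⊕-degree (C-degree 1ℚ) X-degree

p₂-degree : Degree≤ p₂ 3
p₂-degree = ⊛-degree (⊛-degree (⊛-degree (C-degree _) X-degree) (⊕-degree (C-degree 1ℚ) X-degree))
                      (⊕-degree (C-degree 1ℚ) (⊛-degree (C-degree _) X-degree))

p₁-degree : Degree≤ p₁ 2
p₁-degree = ⊛-degree (C-degree _) (⊕-degree (⊕-degree (C-degree _) (⊛-degree (C-degree _) X-degree))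
                                               (⊛-degree (⊛-degree (C-degree _) X-degree) X-degree))

p₀-degree : Degree≤ p₀ 1
p₀-degree = ⊛-degree (C-degree _) (⊕-degree (C-degree 1ℚ) (⊛-degree (C-degree _) X-degree))

p₃-coeff : ∀ g m → (p₃ ⊛ d (d (d g))) (suc m)
  ≡ ι 8 * (fallingFactorial (ι m) 1 * d (d g) m) + ι 16 * (fallingFactorial (ι m) 2 * d g m)
    + ι 8 * (fallingFactorial (ι m) 3 * g m)
p₃-coeff g m = trans (polynomial-⊛ p₃-degree (d (d (d g))) (suc m))
  (combine (d (d (d g)) (suc m)) (d (d (d g)) m) (shift-d^ 1 (d (d g)) m) (shift-d^ 2 (d g) m) (shift-d^ 3 g m))
  where
  combine : ∀ a b {c d e c′ d′ e′} → c ≡ c′ → d ≡ d′ → e ≡ e′ →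
            0ℚ * a + 0ℚ * b + ι 8 * c + ι 16 * d + ι 8 * e ≡ ι 8 * c′ + ι 16 * d′ + ι 8 * e′
  combine a b {c} {d} {e} refl refl refl = solve (a ∷ b ∷ c ∷ d ∷ e ∷ []) ℚ-ring

p₂-coeff : ∀ g m → (p₂ ⊛ d (d g)) (suc m)
  ≡ ι 24 * d (d g) m + ι 72 * (fallingFactorial (ι m) 1 * d g m) + ι 48 * (fallingFactorial (ι m) 2 * g m)
p₂-coeff g m = trans (polynomial-⊛ p₂-degree (d (d g)) (suc m))
  (combine (d (d g) (suc m)) (d (d g) m) (shift-d^ 1 (d g) m) (shift-d^ 2 g m))
  where
  combine : ∀ a b {c d c′ d′} → c ≡ c′ → d ≡ d′ →
            0ℚ * a + ι 24 * b + ι 72 * c + ι 48 * d ≡ ι 24 * b + ι 72 * c′ + ι 48 * d′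
  combine a b {c} {d} refl refl = solve (a ∷ b ∷ c ∷ d ∷ []) ℚ-ring

p₁-coeff : ∀ g m → (p₁ ⊛ d g) (suc m)
  ≡ ι 8 * d g (suc m) + ι 54 * d g m + ι 54 * (fallingFactorial (ι m) 1 * g m)
p₁-coeff g m = trans (polynomial-⊛ p₁-degree (d g) (suc m))
  (cong (λ t → ι 8 * d g (suc m) + ι 54 * d g m + ι 54 * t) (shift-d^ 1 g m))

p₀-coeff : ∀ g m → (p₀ ⊛ g) (suc m) ≡ ι 3 * g (suc m) + ι 6 * g m
p₀-coeff g m = polynomial-⊛ p₀-degree g (suc m)

DW-coeff-suc : ∀ g m →
  DW g (suc m) ≡ ι 8 * (ι m + ι 2) * (ι m + ι 2) * (ι m + ι 2) * g (suc (suc m))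
               + (ι 2 * ι m + ι 3) * (ι 8 * ι m * ι m + ι 24 * ι m + ι 19) * g (suc m)
               + ι 2 * (ι m + 1ℚ) * (ι 2 * ι m + 1ℚ) * (ι 2 * ι m + ι 3) * g m
DW-coeff-suc g m =
  trans (cong₂ _+_ (cong₂ _+_ (cong₂ _+_ (p₃-coeff g m) (p₂-coeff g m)) (p₁-coeff g m)) (p₀-coeff g m))
        (collect (ι m) (ι (suc m)) (ι (suc (suc m))) (g m) (g (suc m)) (g (suc (suc m)))
                 (ι-suc m) (ι-suc (suc m)))
  where
  -- falling factorials appear unfolded: the ring solver does not unfold definitions
  collect : ∀ x y₁ y₂ g₀ g₁ g₂ → y₁ ≡ x + 1ℚ → y₂ ≡ y₁ + 1ℚ →
      ι 8 * (x * 1ℚ * (y₁ * (y₂ * g₂))) + ι 16 * (x * ((x - 1ℚ) * 1ℚ) * (y₁ * g₁))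
        + ι 8 * (x * ((x - 1ℚ) * ((x - 1ℚ - 1ℚ) * 1ℚ)) * g₀)
    + (ι 24 * (y₁ * (y₂ * g₂)) + ι 72 * (x * 1ℚ * (y₁ * g₁)) + ι 48 * (x * ((x - 1ℚ) * 1ℚ) * g₀))
    + (ι 8 * (y₂ * g₂) + ι 54 * (y₁ * g₁) + ι 54 * (x * 1ℚ * g₀))
    + (ι 3 * g₁ + ι 6 * g₀)
    ≡ ι 8 * (x + ι 2) * (x + ι 2) * (x + ι 2) * g₂
    + (ι 2 * x + ι 3) * (ι 8 * x * x + ι 24 * x + ι 19) * g₁
    + ι 2 * (x + 1ℚ) * (ι 2 * x + 1ℚ) * (ι 2 * x + ι 3) * g₀
  collect x _ _ g₀ g₁ g₂ refl refl = solve (x ∷ g₀ ∷ g₁ ∷ g₂ ∷ []) ℚ-ring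

DW-coeff-zero : ∀ g → DW g 0 ≡ ι 8 * g 1 + ι 3 * g 0
DW-coeff-zero g = drop-zeros (d (d (d g)) 0) (d (d g) 0) (g 0) (g 1)
  where
  drop-zeros : ∀ a b g₀ g₁ → 0ℚ * a + 0ℚ * b + ι 8 * (ι 1 * g₁) + ι 3 * g₀ ≡ ι 8 * g₁ + ι 3 * g₀
  drop-zeros = solve-∀ ℚ-ring

gbinom-½-suc : ∀ n → ι 2 * ι (suc n) * gbinom -½ (suc n) ≡ - (ι 2 * ι n + 1ℚ) * gbinom -½ n
gbinom-½-suc n = ratio (ι n) (ι (suc n)) (gbinom -½ n) (+ 1 / suc n) (ι-suc n) (ι-*-/ 1 (suc n))
  where
  ratio : ∀ x y b u → y ≡ x + 1ℚ → y * u ≡ 1ℚ →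
          ι 2 * y * (b * ((-½ - x) * u)) ≡ - (ι 2 * x + 1ℚ) * b
  ratio x y b u refl yu≡1 = begin
    ι 2 * (x + 1ℚ) * (b * ((-½ - x) * u))    ≡⟨ solve (x ∷ b ∷ u ∷ []) ℚ-ring ⟩
    - (ι 2 * x + 1ℚ) * b * ((x + 1ℚ) * u)    ≡⟨ cong (- (ι 2 * x + 1ℚ) * b *_) yu≡1 ⟩
    - (ι 2 * x + 1ℚ) * b * 1ℚ               ≡⟨ *-identityʳ _ ⟩
    - (ι 2 * x + 1ℚ) * b                    ∎
    where open ≡-Reasoning

recurrence-transfer : ∀ x y₁ y₂ b₀ b₁ b₂ J₀ J₁ J₂ → y₁ ≡ x + 1ℚ → y₂ ≡ y₁ + 1ℚ →
  ι 2 * y₁ * b₁ ≡ - (ι 2 * x + 1ℚ) * b₀ → ι 2 * y₂ * b₂ ≡ - (ι 2 * y₁ + 1ℚ) * b₁ →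
    ι 8 * (x + ι 2) * (x + ι 2) * (x + ι 2) * (b₂ * J₂)
  + (ι 2 * x + ι 3) * (ι 8 * x * x + ι 24 * x + ι 19) * (b₁ * J₁)
  + ι 2 * (x + 1ℚ) * (ι 2 * x + 1ℚ) * (ι 2 * x + ι 3) * (b₀ * J₀)
  ≡ - (ι 2 * y₁ + 1ℚ) * b₁ * (ι 4 * y₂ * y₂ * J₂ - (ι 8 * y₂ * y₂ - ι 8 * y₂ + ι 3) * J₁ + ι 4 * y₁ * y₁ * J₀)
recurrence-transfer x _ _ b₀ b₁ b₂ J₀ J₁ J₂ refl refl b₁-rec b₂-rec = begin
    ι 8 * (x + ι 2) * (x + ι 2) * (x + ι 2) * (b₂ * J₂)
  + (ι 2 * x + ι 3) * (ι 8 * x * x + ι 24 * x + ι 19) * (b₁ * J₁)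
  + ι 2 * (x + 1ℚ) * (ι 2 * x + 1ℚ) * (ι 2 * x + ι 3) * (b₀ * J₀)
      ≡⟨ solve vars ℚ-ring ⟩
    ι 4 * (x + ι 2) * (x + ι 2) * J₂ * (ι 2 * (x + 1ℚ + 1ℚ) * b₂)
  + (ι 2 * x + ι 3) * (ι 8 * x * x + ι 24 * x + ι 19) * (b₁ * J₁)
  - ι 2 * (x + 1ℚ) * (ι 2 * x + ι 3) * J₀ * (- (ι 2 * x + 1ℚ) * b₀)
      ≡⟨ cong₂ (λ p q → ι 4 * (x + ι 2) * (x + ι 2) * J₂ * p
                        + (ι 2 * x + ι 3) * (ι 8 * x * x + ι 24 * x + ι 19) * (b₁ * J₁)
                        - ι 2 * (x + 1ℚ) * (ι 2 * x + ι 3) * J₀ * q)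
               b₂-rec (sym b₁-rec) ⟩
    ι 4 * (x + ι 2) * (x + ι 2) * J₂ * (- (ι 2 * (x + 1ℚ) + 1ℚ) * b₁)
  + (ι 2 * x + ι 3) * (ι 8 * x * x + ι 24 * x + ι 19) * (b₁ * J₁)
  - ι 2 * (x + 1ℚ) * (ι 2 * x + ι 3) * J₀ * (ι 2 * (x + 1ℚ) * b₁)
      ≡⟨ solve vars ℚ-ring ⟩
    - (ι 2 * (x + 1ℚ) + 1ℚ) * b₁ * (ι 4 * (x + 1ℚ + 1ℚ) * (x + 1ℚ + 1ℚ) * J₂
      - (ι 8 * (x + 1ℚ + 1ℚ) * (x + 1ℚ + 1ℚ) - ι 8 * (x + 1ℚ + 1ℚ) + ι 3) * J₁
      + ι 4 * (x + 1ℚ) * (x + 1ℚ) * J₀) ∎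
  where
  open ≡-Reasoning
  vars : List ℚ
  vars = x ∷ b₀ ∷ b₁ ∷ b₂ ∷ J₀ ∷ J₁ ∷ J₂ ∷ []

DW-gSeries : ∀ J m → DW (gSeries J) (suc m) ≡ - (ι 2 * ι (suc m) + 1ℚ) * gbinom -½ (suc m) * recLHS J m
DW-gSeries J m = trans (DW-coeff-suc (gSeries J) m)
  (recurrence-transfer (ι m) (ι (suc m)) (ι (suc (suc m)))
                       (gbinom -½ m) (gbinom -½ (suc m)) (gbinom -½ (suc (suc m)))
                       (J m) (J (suc m)) (J (suc (suc m)))
                       (ι-suc m) (ι-suc (suc m)) (gbinom-½-suc m) (gbinom-½-suc (suc m)))

ι-oddDF-suc : ∀ n → ι (oddDF (suc n)) ≡ ι (oddDF n) * (ι 2 * ι n + 1ℚ)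
ι-oddDF-suc n = trans (ι-* (oddDF n) (suc (2 ℕ.* n)))
                      (cong (ι (oddDF n) *_) (trans (ι-suc (2 ℕ.* n)) (cong (_+ 1ℚ) (ι-* 2 n))))

gbinom-½-closed : ∀ n → gbinom -½ n * ι (2 ℕ.^ n) * ι (n ℕ.!) ≡ invOnePlusX n * ι (oddDF n)
gbinom-½-closed zero    = refl
gbinom-½-closed (suc n) = begin
  gbinom -½ (suc n) * ι (2 ℕ.* 2 ℕ.^ n) * ι (suc n ℕ.* n ℕ.!)
    ≡⟨ cong₂ (λ p q → gbinom -½ (suc n) * p * q) (ι-* 2 (2 ℕ.^ n)) (ι-* (suc n) (n ℕ.!)) ⟩
  gbinom -½ (suc n) * (ι 2 * ι (2 ℕ.^ n)) * (ι (suc n) * ι (n ℕ.!))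
    ≡⟨ closed-suc (ι n) (ι (suc n)) (gbinom -½ n) (gbinom -½ (suc n)) (ι (2 ℕ.^ n)) (ι (n ℕ.!))
                  (invOnePlusX n) (ι (oddDF n)) (gbinom-½-suc n) (gbinom-½-closed n) ⟩
  - invOnePlusX n * (ι (oddDF n) * (ι 2 * ι n + 1ℚ))
    ≡⟨ cong (- invOnePlusX n *_) (ι-oddDF-suc n) ⟨
  - invOnePlusX n * ι (oddDF n ℕ.* suc (2 ℕ.* n))
    ∎
  where
  open ≡-Reasoning
  closed-suc : ∀ x y b b′ A F s O → ι 2 * y * b′ ≡ - (ι 2 * x + 1ℚ) * b → b * A * F ≡ s * O →
         b′ * (ι 2 * A) * (y * F) ≡ - s * (O * (ι 2 * x + 1ℚ))
  closed-suc x y b b′ A F s O b′-rec closed = begin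
    b′ * (ι 2 * A) * (y * F)          ≡⟨ solve (y ∷ b′ ∷ A ∷ F ∷ []) ℚ-ring ⟩
    ι 2 * y * b′ * (A * F)            ≡⟨ cong (_* (A * F)) b′-rec ⟩
    - (ι 2 * x + 1ℚ) * b * (A * F)    ≡⟨ solve (x ∷ b ∷ A ∷ F ∷ []) ℚ-ring ⟩
    - (ι 2 * x + 1ℚ) * (b * A * F)    ≡⟨ cong (- (ι 2 * x + 1ℚ) *_) closed ⟩
    - (ι 2 * x + 1ℚ) * (s * O)        ≡⟨ solve (x ∷ s ∷ O ∷ []) ℚ-ring ⟩
    - s * (O * (ι 2 * x + 1ℚ))        ∎

gbinom-½-rhsJ3 : ∀ n → - (ι 2 * ι n + 1ℚ) * gbinom -½ n * rhsJ3 (suc n) ≡ -[1+ 1 ] / 1 * invOnePlusX n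
gbinom-½-rhsJ3 n = *-cancelʳ-invertible (ι-*-/ 1 (oddDF n) {{oddDF-nonZero n}})
  (scaled (ι n) (gbinom -½ n) (rhsJ3 (suc n)) (ι (2 ℕ.^ n)) (ι (n ℕ.!)) (invOnePlusX n) (ι (oddDF n))
          (ι (oddDF (suc n))) (ι-oddDF-suc n) cleared (gbinom-½-closed n))
  where
  cleared : ι (oddDF (suc n)) * rhsJ3 (suc n) ≡ ι 2 * ι (2 ℕ.^ n) * ι (n ℕ.!)
  cleared = trans (ι-*-/ (2 ℕ.^ suc n ℕ.* n ℕ.!) (oddDF (suc n)) {{oddDF-nonZero (suc n)}})
                  (trans (ι-* (2 ℕ.^ suc n) (n ℕ.!)) (cong (_* ι (n ℕ.!)) (ι-* 2 (2 ℕ.^ n))))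
  scaled : ∀ x b r A F s O D → D ≡ O * (ι 2 * x + 1ℚ) → D * r ≡ ι 2 * A * F → b * A * F ≡ s * O →
             - (ι 2 * x + 1ℚ) * b * r * O ≡ -[1+ 1 ] / 1 * s * O
  scaled x b r A F s O D refl Dr≡ closed = begin
    - (ι 2 * x + 1ℚ) * b * r * O          ≡⟨ solve (x ∷ b ∷ r ∷ O ∷ []) ℚ-ring ⟩
    - b * (O * (ι 2 * x + 1ℚ) * r)        ≡⟨ cong (λ t → - b * t) Dr≡ ⟩
    - b * (ι 2 * A * F)                   ≡⟨ solve (b ∷ A ∷ F ∷ []) ℚ-ring ⟩
    - ι 2 * (b * A * F)                   ≡⟨ cong (- ι 2 *_) closed ⟩
    - ι 2 * (s * O)                       ≡⟨ solve (s ∷ O ∷ []) ℚ-ring ⟩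
    -[1+ 1 ] / 1 * s * O                  ∎
    where open ≡-Reasoning

proposition7p3 :
    ((J₂ : ℕ → ℚ) → J₂ 0 ≡ 1ℚ → J₂ 1 ≡ + 3 / 4
      → (∀ m → recLHS J₂ m ≡ 0ℚ)
      → DW (gSeries J₂) ≈ₛ C 0ℚ)
    ×
    ((J₃ : ℕ → ℚ) → J₃ 0 ≡ 0ℚ → J₃ 1 ≡ + 1 / 2
      → (∀ m → recLHS J₃ m ≡ rhsJ3 (suc (suc m)))
      → DW (gSeries J₃) ≈ₛ (λ n → -[1+ 1 ] / 1 * invOnePlusX n))
proposition7p3 = homogeneous , inhomogeneous
  where
  constant-term : ∀ J {a b} → J 1 ≡ a → J 0 ≡ b → DW (gSeries J) 0 ≡ ι 8 * (gbinom -½ 1 * a) + ι 3 * (1ℚ * b)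
  constant-term J J₁ J₀ =
    trans (DW-coeff-zero (gSeries J)) (cong₂ (λ a b → ι 8 * (gbinom -½ 1 * a) + ι 3 * (1ℚ * b)) J₁ J₀)

  weight : ℕ → ℚ
  weight m = - (ι 2 * ι (suc m) + 1ℚ) * gbinom -½ (suc m)

  homogeneous : (J : ℕ → ℚ) → J 0 ≡ 1ℚ → J 1 ≡ + 3 / 4 → (∀ m → recLHS J m ≡ 0ℚ) → DW (gSeries J) ≈ₛ C 0ℚ
  homogeneous J J₀ J₁ rec zero    = constant-term J J₁ J₀
  homogeneous J J₀ J₁ rec (suc m) =
    trans (DW-gSeries J m) (trans (cong (weight m *_) (rec m)) (*-zeroʳ (weight m)))

  inhomogeneous : (J : ℕ → ℚ) → J 0 ≡ 0ℚ → J 1 ≡ + 1 / 2 → (∀ m → recLHS J m ≡ rhsJ3 (suc (suc m)))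
                → DW (gSeries J) ≈ₛ (λ n → -[1+ 1 ] / 1 * invOnePlusX n)
  inhomogeneous J J₀ J₁ rec zero    = constant-term J J₁ J₀
  inhomogeneous J J₀ J₁ rec (suc m) =
    trans (DW-gSeries J m) (trans (cong (weight m *_) (rec m)) (gbinom-½-rhsJ3 (suc m)))
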